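{- Let $n=pq$ be a product of two distinct odd primes $p$ and $q$. Then $n$ is not a weak Carmichael number.
   Context: A composite positive integer $n$ is called a weak Carmichael number if $\sum_{1\le k\le n-1,\ \gcd(k,n)=1} k^{n-1}\equiv \varphi(n)\pmod{n}$, where $\varphi$ is Euler's totient function. -}

module Defs where

open import Data.Nat using (ℕ; zero; suc; _+_; _*_; _∸_; _^_; _≟_; _≤_)
open import Data.Nat.GCD using (gcd)
open import Data.Nat.Primality using (Composite)
open import Data.Integer using (ℤ; +_; _-_)
open import Data.Integer.Divisibility using () renaming (_∣_ to _∣ℤ_)
open import Data.List using (List; filter; map; length; upTo)
open import Data.Nat.ListAction using (sum)
open import Data.Product using (_×_)
open import Relation.Nullary.Decidable using (does)
open import Relation.Binary.PropositionalEquality using (_≡_)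

-- The list of k with 1 ≤ k ≤ n - 1 and gcd(k, n) = 1.
-- (k = 0 is excluded automatically for n ≥ 2 since gcd 0 n = n ≠ 1.)
units : ℕ → List ℕ
units n = filter (λ k → gcd k n ≟ 1) (map suc (upTo (n ∸ 1)))

-- Euler's totient function: number of 1 ≤ k ≤ n with gcd(k,n) = 1
-- (for n ≥ 2 this equals the number of such k ≤ n - 1).
φ : ℕ → ℕ
φ n = length (filter (λ k → gcd k n ≟ 1) (map suc (upTo n)))

powerSum : ℕ → ℕ
powerSum n = sum (map (λ k → k ^ (n ∸ 1)) (units n))

_≡_[mod_] : ℕ → ℕ → ℕ → Set
a ≡ b [mod n ] = (+ n) ∣ℤ ((+ a) - (+ b))

WeakCarmichael : ℕ → Set
WeakCarmichael n = Composite n × (powerSum n ≡ φ n [mod n ])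

-- Let p < q. Modulo q, Fermat's little theorem gives k ^ (pq − 1) ≡ k ^ (p − 1) for every k, and
-- Σ_{k<N} k ^ j ≡ 0 whenever q ∣ N and j < q − 1 (by the recurrence for power sums obtained from
-- the binomial theorem). Split the k < pq into units, multiples of p, and multiples of q prime to p.
-- The sum of k ^ (pq − 1) over all k < pq and over the multiples of p is ≡ 0, and each term over
-- the multiples of q is ≡ 0, so q divides the power sum over the units. The same split counts
-- φ(pq) = pq − q − (p − 1) ≡ −(p − 1) ≢ 0 (mod q). So the two sides are incongruent modulo q,
-- hence modulo pq.
module Submission where

open import Defs
open import Data.Nat
open import Data.Nat.Properties
open import Data.Nat.Divisibility
open import Data.Nat.Induction using (<-rec)
open import Data.Nat.Combinatorics using (_C_; nCn≡1; nC1≡n; nCk≡nC[n∸k]; nCk+nC[k+1]≡[n+1]C[k+1])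
open import Data.Nat.Primality
  using (Prime; euclidsLemma; prime⇒nonZero; prime⇒nonTrivial; prime⇒irreducible)
open import Data.Nat.GCD using (gcd; gcd-greatest)
open import Data.Nat.Coprimality as Coprime using (Coprime; coprime-divisor; coprime⇒gcd≡1)
open import Data.Nat.ListAction using (sum)
open import Data.Fin using (Fin; toℕ)
open import Data.List using (List; []; _∷_; map; filter; length; upTo; applyUpTo)
open import Data.List.Properties using (map-∘)
open import Data.Product using (_,_)
open import Data.Sum using (inj₁; inj₂)
import Data.Integer as ℤ
open import Data.Integer.Properties using (pos-+; pos-*; abs-*)
open import Data.Integer.Divisibility.Signed as Signed using (divides; ∣ᵤ⇒∣; ∣⇒∣ᵤ)
open import Relation.Nullary using (¬_; Dec; yes; no; contradiction)
open import Relation.Unary using (Decidable)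
open import Relation.Binary.Definitions using (tri<; tri≈; tri>)
open import Relation.Binary.PropositionalEquality
open import Algebra.Properties.Semiring.Exp +-*-semiring using () renaming (_^_ to _^ₛ_)
open import Algebra.Properties.Semiring.Mult +-*-semiring using (_×_)
open import Algebra.Properties.Semiring.Sum +-*-semiring using () renaming (sum to ∑ᶠ)
import Algebra.Properties.CommutativeSemiring.Binomial +-*-commutativeSemiring as Binomial
import Algebra.Properties.CommutativeSemiring.Exp +-*-commutativeSemiring as CommExp
import Data.Nat.Tactic.RingSolver as ℕ-Solver
import Data.Integer.Tactic.RingSolver as ℤ-Solver

∑< : ℕ → (ℕ → ℕ) → ℕ
∑< zero    f = 0
∑< (suc N) f = f 0 + ∑< N (λ k → f (suc k))

infixl 10 ∑<
syntax ∑< N (λ k → e) = ∑[ k < N ] e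

∑<-cong : ∀ N {f g : ℕ → ℕ} → (∀ k → k < N → f k ≡ g k) → ∑[ k < N ] f k ≡ ∑[ k < N ] g k
∑<-cong zero    f≡g = refl
∑<-cong (suc N) f≡g = cong₂ _+_ (f≡g 0 z<s) (∑<-cong N (λ k k<N → f≡g (suc k) (s<s k<N)))

∑<-suc : ∀ N (f : ℕ → ℕ) → ∑[ k < suc N ] f k ≡ ∑[ k < N ] f k + f N
∑<-suc zero    f = +-comm (f 0) 0
∑<-suc (suc N) f = trans (cong (f 0 +_) (∑<-suc N (λ k → f (suc k)))) (sym (+-assoc (f 0) _ _))

∑<-++ : ∀ M N (f : ℕ → ℕ) → ∑[ k < M + N ] f k ≡ ∑[ k < M ] f k + ∑[ k < N ] f (M + k)
∑<-++ zero    N f = refl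
∑<-++ (suc M) N f = trans (cong (f 0 +_) (∑<-++ M N (λ k → f (suc k)))) (sym (+-assoc (f 0) _ _))

∑<-+ : ∀ N (f g : ℕ → ℕ) → ∑[ k < N ] (f k + g k) ≡ ∑[ k < N ] f k + ∑[ k < N ] g k
∑<-+ zero    f g = refl
∑<-+ (suc N) f g = trans (cong (f 0 + g 0 +_) (∑<-+ N (λ k → f (suc k)) (λ k → g (suc k))))
                         (+-+-exchange (f 0) (g 0) _ _)
  where
  +-+-exchange : ∀ a b c d → (a + b) + (c + d) ≡ (a + c) + (b + d)
  +-+-exchange = ℕ-Solver.solve-∀

∑<-*ˡ : ∀ N c (f : ℕ → ℕ) → ∑[ k < N ] (c * f k) ≡ c * ∑[ k < N ] f k
∑<-*ˡ zero    c f = sym (*-zeroʳ c)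
∑<-*ˡ (suc N) c f =
  trans (cong (c * f 0 +_) (∑<-*ˡ N c (λ k → f (suc k)))) (sym (*-distribˡ-+ c (f 0) _))

∑<-zero : ∀ N {f : ℕ → ℕ} → (∀ k → k < N → f k ≡ 0) → ∑[ k < N ] f k ≡ 0
∑<-zero N f≡0 = trans (∑<-cong N f≡0) (∑<-*ˡ N 0 (λ _ → 0))

∑<-const : ∀ N c → ∑[ k < N ] c ≡ N * c
∑<-const zero    c = refl
∑<-const (suc N) c = cong (c +_) (∑<-const N c)

∑<-∣ : ∀ {d} N {f : ℕ → ℕ} → (∀ k → k < N → d ∣ f k) → d ∣ ∑[ k < N ] f k
∑<-∣ zero    d∣f = _ ∣0
∑<-∣ (suc N) d∣f = ∣m∣n⇒∣m+n (d∣f 0 z<s) (∑<-∣ N (λ k k<N → d∣f (suc k) (s<s k<N)))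

∑ᶠ≡∑< : ∀ N (f : ℕ → ℕ) → ∑ᶠ (λ (i : Fin N) → f (toℕ i)) ≡ ∑[ k < N ] f k
∑ᶠ≡∑< zero    f = refl
∑ᶠ≡∑< (suc N) f = cong (f 0 +_) (∑ᶠ≡∑< N (λ k → f (suc k)))

×≡* : ∀ m n → m × n ≡ m * n
×≡* zero    n = refl
×≡* (suc m) n = cong (n +_) (×≡* m n)

^ₛ≡^ : ∀ m n → m ^ₛ n ≡ m ^ n
^ₛ≡^ m zero    = refl
^ₛ≡^ m (suc n) = cong (m *_) (^ₛ≡^ m n)

[m*n]^k≡m^k*n^k : ∀ m n k → (m * n) ^ k ≡ m ^ k * n ^ k
[m*n]^k≡m^k*n^k m n k = begin
  (m * n) ^ k      ≡⟨ ^ₛ≡^ (m * n) k ⟨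
  (m * n) ^ₛ k     ≡⟨ CommExp.^-distrib-* m n k ⟩
  m ^ₛ k * n ^ₛ k  ≡⟨ cong₂ _*_ (^ₛ≡^ m k) (^ₛ≡^ n k) ⟩
  m ^ k * n ^ k    ∎
  where open ≡-Reasoning

binomial-theorem : ∀ n x → suc x ^ n ≡ ∑[ k < suc n ] ((n C k) * x ^ k)
binomial-theorem n x = begin
  suc x ^ n                                            ≡⟨ cong (_^ n) (+-comm 1 x) ⟩
  (x + 1) ^ n                                          ≡⟨ ^ₛ≡^ (x + 1) n ⟨
  (x + 1) ^ₛ n                                         ≡⟨ Binomial.theorem n x 1 ⟩
  ∑ᶠ (λ (i : Fin (suc n)) → term (toℕ i))              ≡⟨ ∑ᶠ≡∑< (suc n) term ⟩
  ∑[ k < suc n ] term k                                ≡⟨ ∑<-cong (suc n) (λ k _ → term≡ k) ⟩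
  ∑[ k < suc n ] ((n C k) * x ^ k)                     ∎
  where
  open ≡-Reasoning
  term : ℕ → ℕ
  term k = (n C k) × (x ^ₛ k * 1 ^ₛ (n ∸ k))
  term≡ : ∀ k → term k ≡ (n C k) * x ^ k
  term≡ k = begin
    (n C k) × (x ^ₛ k * 1 ^ₛ (n ∸ k))  ≡⟨ ×≡* (n C k) _ ⟩
    (n C k) * (x ^ₛ k * 1 ^ₛ (n ∸ k))  ≡⟨ cong₂ (λ a b → (n C k) * (a * b))
                                                 (^ₛ≡^ x k) (trans (^ₛ≡^ 1 (n ∸ k)) (^-zeroˡ (n ∸ k))) ⟩
    (n C k) * (x ^ k * 1)              ≡⟨ cong ((n C k) *_) (*-identityʳ (x ^ k)) ⟩
    (n C k) * x ^ k                    ∎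

[k+1]*[n+1]C[k+1]≡[n+1]*nCk : ∀ n k → suc k * (suc n C suc k) ≡ suc n * (n C k)
[k+1]*[n+1]C[k+1]≡[n+1]*nCk zero    zero    = refl
[k+1]*[n+1]C[k+1]≡[n+1]*nCk zero    (suc k) = *-zeroʳ (suc (suc k))
[k+1]*[n+1]C[k+1]≡[n+1]*nCk (suc m) zero    =
  trans (*-identityˡ _) (trans (nC1≡n (suc (suc m))) (sym (*-identityʳ _)))
[k+1]*[n+1]C[k+1]≡[n+1]*nCk (suc m) (suc k) = begin
  suc (suc k) * (suc (suc m) C suc (suc k))    ≡⟨ cong (suc (suc k) *_) (nCk+nC[k+1]≡[n+1]C[k+1] (suc m) (suc k)) ⟨
  suc (suc k) * (A + A′)                       ≡⟨ regroup k A A′ ⟩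
  A + suc k * A + suc (suc k) * A′             ≡⟨ cong₂ (λ s t → A + s + t) ([k+1]*[n+1]C[k+1]≡[n+1]*nCk m k)
                                                                           ([k+1]*[n+1]C[k+1]≡[n+1]*nCk m (suc k)) ⟩
  A + suc m * (m C k) + suc m * (m C suc k)    ≡⟨ +-assoc A _ _ ⟩
  A + (suc m * (m C k) + suc m * (m C suc k))  ≡⟨ cong (A +_) (*-distribˡ-+ (suc m) (m C k) (m C suc k)) ⟨
  A + suc m * ((m C k) + (m C suc k))          ≡⟨ cong (λ t → A + suc m * t) (nCk+nC[k+1]≡[n+1]C[k+1] m k) ⟩
  A + suc m * A                                ∎
  where
  open ≡-Reasoning
  A A′ : ℕ
  A  = suc m C suc k
  A′ = suc m C suc (suc k)
  regroup : ∀ k a b → suc (suc k) * (a + b) ≡ a + suc k * a + suc (suc k) * b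
  regroup = ℕ-Solver.solve-∀

prime∣pCk : ∀ {p} k → Prime p → 0 < k → k < p → p ∣ p C k
prime∣pCk {suc n} (suc j) p-prime _ k<p
  with euclidsLemma (suc j) (suc n C suc j) p-prime
         (subst (suc n ∣_) (sym ([k+1]*[n+1]C[k+1]≡[n+1]*nCk n j)) (m∣m*n (n C j)))
... | inj₁ p∣k  = contradiction (∣⇒≤ p∣k) (<⇒≱ k<p)
... | inj₂ p∣pCk = p∣pCk

[n+1]Cn≡n+1 : ∀ n → suc n C n ≡ suc n
[n+1]Cn≡n+1 n =
  trans (nCk≡nC[n∸k] (n≤1+n n)) (trans (cong (suc n C_) (m+n∸n≡m 1 n)) (nC1≡n (suc n)))

-- Power sums modulo a prime

-- Sum (a + 1) ^ (k + 1) = Σ_j C(k+1, j) a ^ j over a < N; the left side telescopes.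
∑^-recurrence : ∀ k N → ∑[ j < suc k ] ((suc k C j) * ∑[ a < N ] (a ^ j)) ≡ N ^ suc k
∑^-recurrence k zero    = ∑<-zero (suc k) (λ j _ → *-zeroʳ (suc k C j))
∑^-recurrence k (suc N) = begin
  ∑[ j < suc k ] ((suc k C j) * ∑[ a < suc N ] (a ^ j))   ≡⟨ ∑<-cong (suc k) (λ j _ → split j) ⟩
  ∑[ j < suc k ] (L j + R j)                              ≡⟨ ∑<-+ (suc k) L R ⟩
  ∑[ j < suc k ] L j + ∑[ j < suc k ] R j                 ≡⟨ cong (_+ ∑[ j < suc k ] R j) (∑^-recurrence k N) ⟩
  N ^ suc k + ∑[ j < suc k ] R j                          ≡⟨ +-comm (N ^ suc k) _ ⟩
  ∑[ j < suc k ] R j + N ^ suc k                          ≡⟨ cong (∑[ j < suc k ] R j +_) top ⟨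
  ∑[ j < suc k ] R j + R (suc k)                          ≡⟨ ∑<-suc (suc k) R ⟨
  ∑[ j < suc (suc k) ] R j                                ≡⟨ binomial-theorem (suc k) N ⟨
  suc N ^ suc k                                           ∎
  where
  open ≡-Reasoning
  L R : ℕ → ℕ
  L j = (suc k C j) * ∑[ a < N ] (a ^ j)
  R j = (suc k C j) * N ^ j
  split : ∀ j → (suc k C j) * ∑[ a < suc N ] (a ^ j) ≡ L j + R j
  split j = trans (cong ((suc k C j) *_) (∑<-suc N (_^ j))) (*-distribˡ-+ (suc k C j) _ _)
  top : R (suc k) ≡ N ^ suc k
  top = trans (cong (_* N ^ suc k) (nCn≡1 (suc k))) (*-identityˡ _)

-- Strong induction on j: the recurrence at k = j writes (j + 1) · S j as N ^ (j + 1) minus a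
-- combination of the S i with i < j, all divisible by q; and q ∤ j + 1.
prime∣∑^ : ∀ {q N} → Prime q → q ∣ N → ∀ j → suc j < q → q ∣ ∑[ a < N ] (a ^ j)
prime∣∑^ {q} {N} q-prime q∣N = <-rec (λ j → suc j < q → q ∣ S j) step
  where
  S : ℕ → ℕ
  S j = ∑[ a < N ] (a ^ j)
  step : ∀ j → (∀ {i} → i < j → suc i < q → q ∣ S i) → suc j < q → q ∣ S j
  step j rec j+1<q with euclidsLemma (suc j) (S j) q-prime q∣[j+1]*S
    where
    q∣lower : q ∣ ∑[ i < j ] ((suc j C i) * S i)
    q∣lower = ∑<-∣ j (λ i i<j → ∣n⇒∣m*n (suc j C i) (rec i<j (<-trans (s<s i<j) j+1<q)))
    q∣all : q ∣ ∑[ i < j ] ((suc j C i) * S i) + (suc j C j) * S j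
    q∣all = subst (q ∣_) (trans (sym (∑^-recurrence j N)) (∑<-suc j (λ i → (suc j C i) * S i)))
                  (∣m⇒∣m*n (N ^ j) q∣N)
    q∣[j+1]*S : q ∣ suc j * S j
    q∣[j+1]*S = subst (λ c → q ∣ c * S j) ([n+1]Cn≡n+1 j) (∣m+n∣m⇒∣n q∣all q∣lower)
  ... | inj₁ q∣j+1 = contradiction (∣⇒≤ q∣j+1) (<⇒≱ j+1<q)
  ... | inj₂ q∣S   = q∣S

module Modulo (q : ℕ) where

  open ℤ using (+_; _-_)

  -- `a ≡ b [mod q ]` unfolds to divisibility of an absolute value, from which Agda cannot infer
  -- `a` and `b`; the record makes them inferable.
  infix 4 _≈_
  record _≈_ (a b : ℕ) : Set where
    constructor wrap
    field unwrap : a ≡ b [mod q ]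
  open _≈_ public

  private
    toℤ : ∀ {a b} → a ≈ b → (+ q) Signed.∣ (+ a - + b)
    toℤ {a} {b} a≈b = ∣ᵤ⇒∣ {+ q} {+ a - + b} (unwrap a≈b)

    fromℤ : ∀ {a b i} → (+ a - + b) ≡ i → (+ q) Signed.∣ i → a ≈ b
    fromℤ a-b≡i q∣i = wrap (∣⇒∣ᵤ (subst ((+ q) Signed.∣_) (sym a-b≡i) q∣i))

  ≈-refl : ∀ {a} → a ≈ a
  ≈-refl {a} = fromℤ (x-x≡0*y (+ a) (+ q)) (divides (+ 0) refl)
    where x-x≡0*y : ∀ x y → x - x ≡ + 0 ℤ.* y
          x-x≡0*y = ℤ-Solver.solve-∀

  ≈-reflexive : ∀ {a b} → a ≡ b → a ≈ b
  ≈-reflexive refl = ≈-refl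

  ≈-sym : ∀ {a b} → a ≈ b → b ≈ a
  ≈-sym {a} {b} a≈b = fromℤ (y-x≡-[x-y] (+ a) (+ b)) (Signed.∣m⇒∣-m (toℤ a≈b))
    where y-x≡-[x-y] : ∀ x y → y - x ≡ ℤ.- (x - y)
          y-x≡-[x-y] = ℤ-Solver.solve-∀

  ≈-trans : ∀ {a b c} → a ≈ b → b ≈ c → a ≈ c
  ≈-trans {a} {b} {c} a≈b b≈c =
    fromℤ (telescope (+ a) (+ b) (+ c)) (Signed.∣m∣n⇒∣m+n (toℤ a≈b) (toℤ b≈c))
    where telescope : ∀ x y z → x - z ≡ (x - y) ℤ.+ (y - z)
          telescope = ℤ-Solver.solve-∀

  ≈-+ : ∀ {a b c d} → a ≈ b → c ≈ d → a + c ≈ b + d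
  ≈-+ {a} {b} {c} {d} a≈b c≈d =
    fromℤ (trans (cong₂ _-_ (pos-+ a c) (pos-+ b d)) (regroup (+ a) (+ b) (+ c) (+ d)))
          (Signed.∣m∣n⇒∣m+n (toℤ a≈b) (toℤ c≈d))
    where regroup : ∀ x y u v → (x ℤ.+ u) - (y ℤ.+ v) ≡ (x - y) ℤ.+ (u - v)
          regroup = ℤ-Solver.solve-∀

  ≈-* : ∀ {a b c d} → a ≈ b → c ≈ d → a * c ≈ b * d
  ≈-* {a} {b} {c} {d} a≈b c≈d =
    fromℤ (trans (cong₂ _-_ (pos-* a c) (pos-* b d)) (regroup (+ a) (+ b) (+ c) (+ d)))
          (Signed.∣m∣n⇒∣m+n (Signed.∣n⇒∣m*n (+ a) (toℤ c≈d)) (Signed.∣m⇒∣m*n (+ d) (toℤ a≈b)))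
    where regroup : ∀ x y u v → x ℤ.* u - y ℤ.* v ≡ x ℤ.* (u - v) ℤ.+ (x - y) ℤ.* v
          regroup = ℤ-Solver.solve-∀

  ≈-^ : ∀ {a b} e → a ≈ b → a ^ e ≈ b ^ e
  ≈-^ zero    a≈b = ≈-refl
  ≈-^ (suc e) a≈b = ≈-* a≈b (≈-^ e a≈b)

  ≈-∑ : ∀ N {f g : ℕ → ℕ} → (∀ k → f k ≈ g k) → ∑[ k < N ] f k ≈ ∑[ k < N ] g k
  ≈-∑ zero    f≈g = ≈-refl
  ≈-∑ (suc N) f≈g = ≈-+ (f≈g 0) (≈-∑ N (λ k → f≈g (suc k)))

  ∣⇒≈0 : ∀ {a} → q ∣ a → a ≈ 0
  ∣⇒≈0 {a} q∣a = wrap (subst (q ∣_) (sym (+-identityʳ a)) q∣a)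

  ≈0⇒∣ : ∀ {a} → a ≈ 0 → q ∣ a
  ≈0⇒∣ {a} a≈0 = subst (q ∣_) (+-identityʳ a) (unwrap a≈0)

  ≡[mod]⇒≈ : ∀ {n a b} → q ∣ n → a ≡ b [mod n ] → a ≈ b
  ≡[mod]⇒≈ q∣n a≡b = wrap (∣-trans q∣n a≡b)

  ≈-*-cancelˡ : Prime q → ∀ {c a b} → ¬ q ∣ c → c * a ≈ c * b → a ≈ b
  ≈-*-cancelˡ q-prime {c} {a} {b} q∤c ca≈cb
    with euclidsLemma c ℤ.∣ + a - + b ∣ q-prime (subst (q ∣_) (abs-* (+ c) (+ a - + b)) q∣c[a-b])
    where
    factor : ∀ x y z → x ℤ.* y - x ℤ.* z ≡ x ℤ.* (y - z)
    factor = ℤ-Solver.solve-∀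
    q∣c[a-b] : q ∣ ℤ.∣ + c ℤ.* (+ a - + b) ∣
    q∣c[a-b] = subst (λ i → q ∣ ℤ.∣ i ∣)
                     (trans (cong₂ _-_ (pos-* c a) (pos-* c b)) (factor (+ c) (+ a) (+ b)))
                     (unwrap ca≈cb)
  ... | inj₁ q∣c   = contradiction q∣c q∤c
  ... | inj₂ q∣a-b = wrap q∣a-b

∣⇒∣^ : ∀ {d a} e → d ∣ a → 0 < e → d ∣ a ^ e
∣⇒∣^ {a = a} (suc e) d∣a _ = ∣m⇒∣m*n (a ^ e) d∣a

a*a^[n∸1]≡a^n : ∀ a {n} → 0 < n → a * a ^ (n ∸ 1) ≡ a ^ n
a*a^[n∸1]≡a^n a 0<n = cong (a ^_) (m+[n∸m]≡n 0<n)

freshmans-dream : ∀ {q} → Prime q → ∀ a → Modulo._≈_ q (suc a ^ q) (1 + a ^ q)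
freshmans-dream {suc r} q-prime a =
  ≈-trans (≈-reflexive (binomial-theorem q a)) (≈-+ (≈-refl {1}) middle+top≈top)
  where
  open Modulo (suc r)
  q = suc r
  T : ℕ → ℕ
  T j = (q C suc j) * a ^ suc j
  q∣middle : q ∣ ∑[ j < r ] T j
  q∣middle = ∑<-∣ r (λ j j<r → ∣m⇒∣m*n (a ^ suc j) (prime∣pCk (suc j) q-prime z<s (s<s j<r)))
  middle+top≈top : ∑[ j < q ] T j ≈ a ^ q
  middle+top≈top = ≈-trans (≈-reflexive (∑<-suc r T))
    (≈-+ (∣⇒≈0 q∣middle) (≈-reflexive (trans (cong (_* a ^ q) (nCn≡1 q)) (*-identityˡ (a ^ q)))))

module _ {q} (q-prime : Prime q) where
  open Modulo q

  private
    0<q : 0 < q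
    0<q = >-nonZero⁻¹ q {{prime⇒nonZero q-prime}}

  fermat : ∀ a → a ^ q ≈ a
  fermat zero    = ∣⇒≈0 (∣⇒∣^ q (q ∣0) 0<q)
  fermat (suc a) = ≈-trans (freshmans-dream q-prime a) (≈-+ (≈-refl {1}) (fermat a))

  ^[p*q∸1]≈^[p∸1] : ∀ {p} → 1 < p → ∀ a → a ^ (p * q ∸ 1) ≈ a ^ (p ∸ 1)
  ^[p*q∸1]≈^[p∸1] {p} 1<p a with q ∣? a
  ... | yes q∣a = ≈-trans (∣⇒≈0 (∣⇒∣^ (p * q ∸ 1) q∣a (m<n⇒0<n∸m 1<pq)))
                          (≈-sym (∣⇒≈0 (∣⇒∣^ (p ∸ 1) q∣a (m<n⇒0<n∸m 1<p))))
    where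
    1<pq : 1 < p * q
    1<pq = *-mono-≤ {2} {p} {1} {q} 1<p 0<q
  ... | no q∤a = ≈-*-cancelˡ q-prime q∤a
                   (≈-trans (≈-reflexive a*a^[pq∸1]≡[a^q]^p)
                   (≈-trans (≈-^ p (fermat a)) (≈-reflexive (sym (a*a^[n∸1]≡a^n a 0<p)))))
    where
    0<p : 0 < p
    0<p = <-trans z<s 1<p
    a*a^[pq∸1]≡[a^q]^p : a * a ^ (p * q ∸ 1) ≡ (a ^ q) ^ p
    a*a^[pq∸1]≡[a^q]^p = begin
      a * a ^ (p * q ∸ 1)  ≡⟨ a*a^[n∸1]≡a^n a (*-mono-< {0} {p} {0} {q} 0<p 0<q) ⟩
      a ^ (p * q)          ≡⟨ cong (a ^_) (*-comm p q) ⟩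
      a ^ (q * p)          ≡⟨ ^-*-assoc a q p ⟨
      (a ^ q) ^ p          ∎
      where open ≡-Reasoning

  prime∣∑^[p*q∸1] : ∀ {p N} → 1 < p → p < q → q ∣ N → q ∣ ∑[ a < N ] (a ^ (p * q ∸ 1))
  prime∣∑^[p*q∸1] {p} {N} 1<p p<q q∣N =
    ≈0⇒∣ (≈-trans (≈-∑ N (^[p*q∸1]≈^[p∸1] 1<p)) (∣⇒≈0 (prime∣∑^ q-prime q∣N (p ∸ 1) p∸1+1<q)))
    where
    p∸1+1<q : suc (p ∸ 1) < q
    p∸1+1<q = subst (_< q) (sym (m+[n∸m]≡n (<-trans z<s 1<p))) p<q

-- Sums restricted by a decidable condition

when : {A : Set} → Dec A → ℕ → ℕ
when (yes _) x = x
when (no _)  x = 0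

unless : {A : Set} → Dec A → ℕ → ℕ
unless (yes _) x = 0
unless (no _)  x = x

when-yes : ∀ {A : Set} (a? : Dec A) → A → ∀ x → when a? x ≡ x
when-yes (yes _) a x = refl
when-yes (no ¬a) a x = contradiction a ¬a

when-no : ∀ {A : Set} (a? : Dec A) → ¬ A → ∀ x → when a? x ≡ 0
when-no (yes a) ¬a x = contradiction a ¬a
when-no (no _)  ¬a x = refl

unless-yes : ∀ {A : Set} (a? : Dec A) → A → ∀ x → unless a? x ≡ 0
unless-yes (yes _) a x = refl
unless-yes (no ¬a) a x = contradiction a ¬a

unless-no : ∀ {A : Set} (a? : Dec A) → ¬ A → ∀ x → unless a? x ≡ x
unless-no (yes a) ¬a x = contradiction a ¬a
unless-no (no _)  ¬a x = refl

when-⇔ : ∀ {A B : Set} (a? : Dec A) (b? : Dec B) → (A → B) → (B → A) → ∀ x → when a? x ≡ when b? x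
when-⇔ (yes _) (yes _) _   _   x = refl
when-⇔ (no _)  (no _)  _   _   x = refl
when-⇔ (yes a) (no ¬b) a⇒b _   x = contradiction (a⇒b a) ¬b
when-⇔ (no ¬a) (yes b) _   b⇒a x = contradiction (b⇒a b) ¬a

∣-unless : ∀ {d A} (a? : Dec A) {x} → d ∣ x → d ∣ unless a? x
∣-unless (yes _) d∣x = _ ∣0
∣-unless (no _)  d∣x = d∣x

∑-multiples : ∀ d .{{_ : NonZero d}} N (f : ℕ → ℕ) →
              ∑[ k < d * N ] when (d ∣? k) (f k) ≡ ∑[ t < N ] f (d * t)
∑-multiples d zero f = cong (λ M → ∑[ k < M ] when (d ∣? k) (f k)) (*-zeroʳ d)
∑-multiples d@(suc d′) (suc N) f = begin
  ∑[ k < d * suc N ] F k                          ≡⟨ cong (λ M → ∑[ k < M ] F k) (*-suc d N) ⟩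
  ∑[ k < d + d * N ] F k                          ≡⟨ ∑<-++ d (d * N) F ⟩
  ∑[ k < d ] F k + ∑[ k < d * N ] F (d + k)        ≡⟨ cong₂ _+_ first-block (∑<-cong (d * N) (λ k _ → shift k)) ⟩
  f 0 + ∑[ k < d * N ] when (d ∣? k) (f (d + k))   ≡⟨ cong₂ _+_ (cong f (sym (*-zeroʳ d)))
                                                              (∑-multiples d N (λ k → f (d + k))) ⟩
  f (d * 0) + ∑[ t < N ] f (d + d * t)            ≡⟨ cong (f (d * 0) +_) (∑<-cong N (λ t _ → cong f (*-suc d t))) ⟨
  ∑[ t < suc N ] f (d * t)                        ∎
  where
  open ≡-Reasoning
  F : ℕ → ℕ
  F k = when (d ∣? k) (f k)
  d∤k+1 : ∀ {k} → k < d′ → ¬ d ∣ suc k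
  d∤k+1 k<d′ d∣k+1 = <⇒≱ (s<s k<d′) (∣⇒≤ d∣k+1)
  first-block : ∑[ k < d ] F k ≡ f 0
  first-block = trans (cong (f 0 +_) (∑<-zero d′ (λ k k<d′ → when-no (d ∣? suc k) (d∤k+1 k<d′) _)))
                      (+-identityʳ (f 0))
  shift : ∀ k → F (d + k) ≡ when (d ∣? k) (f (d + k))
  shift k = when-⇔ (d ∣? (d + k)) (d ∣? k)
                   (λ d∣d+k → ∣m+n∣m⇒∣n d∣d+k ∣-refl) (∣m∣n⇒∣m+n ∣-refl) (f (d + k))

∑-unless-p∣q*t : ∀ {p q} → Prime p → ¬ p ∣ q → ∑[ t < p ] unless (p ∣? (q * t)) 1 ≡ p ∸ 1
∑-unless-p∣q*t {suc p′} {q} p-prime p∤q = begin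
  unless (p ∣? (q * 0)) 1 + ∑[ t < p′ ] unless (p ∣? (q * suc t)) 1
    ≡⟨ cong₂ _+_ (unless-yes (p ∣? (q * 0)) p∣q*0 1)
                 (∑<-cong p′ (λ t t<p′ → unless-no (p ∣? (q * suc t)) (p∤q*[t+1] t<p′) 1)) ⟩
  ∑[ t < p′ ] 1
    ≡⟨ trans (∑<-const p′ 1) (*-identityʳ p′) ⟩
  p′ ∎
  where
  open ≡-Reasoning
  p = suc p′
  p∣q*0 : p ∣ q * 0
  p∣q*0 = subst (p ∣_) (sym (*-zeroʳ q)) (p ∣0)
  p∤q*[t+1] : ∀ {t} → t < p′ → ¬ p ∣ q * suc t
  p∤q*[t+1] t<p′ p∣q*[t+1] with euclidsLemma q _ p-prime p∣q*[t+1]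
  ... | inj₁ p∣q   = p∤q p∣q
  ... | inj₂ p∣t+1 = <⇒≱ (s<s t<p′) (∣⇒≤ p∣t+1)

-- Units modulo a product of two primes

prime∤⇒coprime : ∀ {p m} → Prime p → ¬ p ∣ m → Coprime p m
prime∤⇒coprime p-prime p∤m (d∣p , d∣m) with prime⇒irreducible p-prime d∣p
... | inj₁ d≡1  = d≡1
... | inj₂ refl = contradiction d∣m p∤m

coprime-* : ∀ {m n o} → Coprime m n → Coprime m o → Coprime m (n * o)
coprime-* {n = n} m⊥n m⊥o (d∣m , d∣n*o) = m⊥o (d∣m , coprime-divisor d⊥n d∣n*o)
  where
  d⊥n : Coprime _ n
  d⊥n (e∣d , e∣n) = m⊥n (∣-trans e∣d d∣m , e∣n)

common-divisor⇒gcd≢1 : ∀ {d m n} → .{{NonTrivial d}} → d ∣ m → d ∣ n → gcd m n ≢ 1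
common-divisor⇒gcd≢1 d∣m d∣n gcd≡1 =
  nonTrivial⇒≢1 (∣1⇒≡1 (subst (_ ∣_) gcd≡1 (gcd-greatest d∣m d∣n)))

∣m+n∣n⇒∣m : ∀ {d m n} → d ∣ m + n → d ∣ n → d ∣ m
∣m+n∣n⇒∣m {d} {m} {n} d∣m+n = ∣m+n∣m⇒∣n (subst (d ∣_) (+-comm m n) d∣m+n)

sum-map-filter : ∀ {P : ℕ → Set} (P? : Decidable P) (f : ℕ → ℕ) xs →
                 sum (map f (filter P? xs)) ≡ sum (map (λ x → when (P? x) (f x)) xs)
sum-map-filter P? f []       = refl
sum-map-filter P? f (x ∷ xs) with P? x
... | yes _ = cong (f x +_) (sum-map-filter P? f xs)
... | no _  = sum-map-filter P? f xs

length≡sum-map-1 : ∀ {A : Set} (xs : List A) → length xs ≡ sum (map (λ _ → 1) xs)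
length≡sum-map-1 []       = refl
length≡sum-map-1 (x ∷ xs) = cong suc (length≡sum-map-1 xs)

sum-map-applyUpTo : ∀ (f g : ℕ → ℕ) N → sum (map f (applyUpTo g N)) ≡ ∑[ k < N ] f (g k)
sum-map-applyUpTo f g zero    = refl
sum-map-applyUpTo f g (suc N) = cong (f (g 0) +_) (sum-map-applyUpTo f (λ k → g (suc k)) N)

sum-filter-map-suc-upTo : ∀ {P : ℕ → Set} (P? : Decidable P) (f : ℕ → ℕ) N → ¬ P 0 →
                          sum (map f (filter P? (map suc (upTo N)))) ≡ ∑[ k < suc N ] when (P? k) (f k)
sum-filter-map-suc-upTo P? f N ¬P0 = begin
  sum (map f (filter P? (map suc (upTo N))))  ≡⟨ sum-map-filter P? f (map suc (upTo N)) ⟩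
  sum (map F (map suc (upTo N)))              ≡⟨ cong sum (map-∘ (upTo N)) ⟨
  sum (map (λ k → F (suc k)) (upTo N))        ≡⟨ sum-map-applyUpTo (λ k → F (suc k)) (λ k → k) N ⟩
  ∑[ k < N ] F (suc k)                        ≡⟨ cong (_+ ∑[ k < N ] F (suc k)) (when-no (P? 0) ¬P0 (f 0)) ⟨
  ∑[ k < suc N ] F k                          ∎
  where
  open ≡-Reasoning
  F : ℕ → ℕ
  F k = when (P? k) (f k)

module _ {p q} (p-prime : Prime p) (q-prime : Prime q) (p<q : p < q) where
  open Modulo q

  private
    instance
      p≢0 = prime⇒nonZero p-prime
      q≢0 = prime⇒nonZero q-prime
      p>1 = prime⇒nonTrivial p-prime
      q>1 = prime⇒nonTrivial q-prime

    n m : ℕ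
    n = p * q
    m = n ∸ 1

    1<p : 1 < p
    1<p = nonTrivial⇒n>1 p

    0<m : 0 < m
    0<m = m<n⇒0<n∸m (*-mono-≤ {2} {p} {1} {q} 1<p (>-nonZero⁻¹ q))

    unit? : ∀ k → Dec (gcd k n ≡ 1)
    unit? k = gcd k n ≟ 1

    U W P : (ℕ → ℕ) → ℕ
    U f = ∑[ k < n ] when (unit? k) (f k)
    W f = ∑[ k < n ] when (q ∣? k) (unless (p ∣? k) (f k))
    P f = ∑[ k < n ] when (p ∣? k) (f k)

  p∤∧q∤⇒gcd≡1 : ∀ k → ¬ p ∣ k → ¬ q ∣ k → gcd k n ≡ 1
  p∤∧q∤⇒gcd≡1 k p∤k q∤k = coprime⇒gcd≡1
    (coprime-* (Coprime.sym (prime∤⇒coprime p-prime p∤k)) (Coprime.sym (prime∤⇒coprime q-prime q∤k)))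

  partition : ∀ k x → when (unit? k) x + when (q ∣? k) (unless (p ∣? k) x) + when (p ∣? k) x ≡ x
  partition k x with p ∣? k | q ∣? k
  ... | yes p∣k | yes _   rewrite when-no (unit? k) (common-divisor⇒gcd≢1 p∣k (m∣m*n q)) x = refl
  ... | yes p∣k | no _    rewrite when-no (unit? k) (common-divisor⇒gcd≢1 p∣k (m∣m*n q)) x = refl
  ... | no p∤k  | yes q∣k rewrite when-no (unit? k) (common-divisor⇒gcd≢1 q∣k (n∣m*n p)) x = +-identityʳ x
  ... | no p∤k  | no q∤k  rewrite when-yes (unit? k) (p∤∧q∤⇒gcd≡1 k p∤k q∤k) x =
    trans (+-identityʳ (x + 0)) (+-identityʳ x)

  ∑-partition : ∀ f → U f + W f + P f ≡ ∑[ k < n ] f k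
  ∑-partition f = begin
    U f + W f + P f                     ≡⟨ cong (_+ P f) (∑<-+ n u w) ⟨
    ∑[ k < n ] (u k + w k) + P f        ≡⟨ ∑<-+ n (λ k → u k + w k) v ⟨
    ∑[ k < n ] (u k + w k + v k)        ≡⟨ ∑<-cong n (λ k _ → partition k (f k)) ⟩
    ∑[ k < n ] f k                      ∎
    where
    open ≡-Reasoning
    u w v : ℕ → ℕ
    u k = when (unit? k) (f k)
    w k = when (q ∣? k) (unless (p ∣? k) (f k))
    v k = when (p ∣? k) (f k)

  W-as-∑ : ∀ f → W f ≡ ∑[ t < p ] unless (p ∣? (q * t)) (f (q * t))
  W-as-∑ f = trans (cong (λ M → ∑[ k < M ] when (q ∣? k) (unless (p ∣? k) (f k))) (*-comm p q))
                   (∑-multiples q p (λ k → unless (p ∣? k) (f k)))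

  P-as-∑ : ∀ f → P f ≡ ∑[ t < q ] f (p * t)
  P-as-∑ = ∑-multiples p q

  q∣U[^m] : q ∣ U (_^ m)
  q∣U[^m] = ∣m+n∣n⇒∣m (∣m+n∣n⇒∣m q∣U+W+P q∣P) q∣W
    where
    q∣U+W+P : q ∣ U (_^ m) + W (_^ m) + P (_^ m)
    q∣U+W+P = subst (q ∣_) (sym (∑-partition (_^ m))) (prime∣∑^[p*q∸1] q-prime 1<p p<q (n∣m*n p))
    q∣W : q ∣ W (_^ m)
    q∣W = subst (q ∣_) (sym (W-as-∑ (_^ m)))
                (∑<-∣ p (λ t _ → ∣-unless (p ∣? (q * t)) (∣⇒∣^ m (m∣m*n t) 0<m)))
    P≡p^m*∑ : P (_^ m) ≡ p ^ m * ∑[ t < q ] (t ^ m)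
    P≡p^m*∑ = trans (P-as-∑ (_^ m))
                    (trans (∑<-cong q (λ t _ → [m*n]^k≡m^k*n^k p t m)) (∑<-*ˡ q (p ^ m) (_^ m)))
    q∣P : q ∣ P (_^ m)
    q∣P = subst (q ∣_) (sym P≡p^m*∑) (∣n⇒∣m*n (p ^ m) (prime∣∑^[p*q∸1] q-prime 1<p p<q ∣-refl))

  U[1]+[p∸1]+q≡n : U (λ _ → 1) + (p ∸ 1) + q ≡ n
  U[1]+[p∸1]+q≡n = begin
    U (λ _ → 1) + (p ∸ 1) + q                ≡⟨ cong₂ (λ w v → U (λ _ → 1) + w + v) W[1] P[1] ⟨
    U (λ _ → 1) + W (λ _ → 1) + P (λ _ → 1)  ≡⟨ ∑-partition (λ _ → 1) ⟩
    ∑[ k < n ] 1                             ≡⟨ trans (∑<-const n 1) (*-identityʳ n) ⟩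
    n                                        ∎
    where
    open ≡-Reasoning
    p∤q : ¬ p ∣ q
    p∤q p∣q with prime⇒irreducible q-prime p∣q
    ... | inj₁ p≡1 = nonTrivial⇒≢1 p≡1
    ... | inj₂ p≡q = <⇒≢ p<q p≡q
    W[1] : W (λ _ → 1) ≡ p ∸ 1
    W[1] = trans (W-as-∑ (λ _ → 1)) (∑-unless-p∣q*t p-prime p∤q)
    P[1] : P (λ _ → 1) ≡ q
    P[1] = trans (P-as-∑ (λ _ → 1)) (trans (∑<-const q 1) (*-identityʳ q))

  q∤U[1] : ¬ q ∣ U (λ _ → 1)
  q∤U[1] q∣U = <⇒≱ (≤-<-trans (m∸n≤m p 1) p<q) (∣⇒≤ {{>-nonZero (m<n⇒0<n∸m 1<p)}} q∣p∸1)
    where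
    q∣U+[p∸1] : q ∣ U (λ _ → 1) + (p ∸ 1)
    q∣U+[p∸1] = ∣m+n∣n⇒∣m (subst (q ∣_) (sym U[1]+[p∸1]+q≡n) (n∣m*n p)) ∣-refl
    q∣p∸1 : q ∣ p ∸ 1
    q∣p∸1 = ∣m+n∣m⇒∣n q∣U+[p∸1] q∣U

  powerSum≡U : powerSum n ≡ U (_^ m)
  powerSum≡U = trans (sum-filter-map-suc-upTo unit? (_^ m) m (common-divisor⇒gcd≢1 (p ∣0) (m∣m*n q)))
                     (cong (λ M → ∑[ k < M ] when (unit? k) (k ^ m)) m+1≡n)
    where
    m+1≡n : suc m ≡ n
    m+1≡n = m+[n∸m]≡n (>-nonZero⁻¹ n {{m*n≢0 p q}})

  φ≡U : φ n ≡ U (λ _ → 1)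
  φ≡U = begin
    φ n                                     ≡⟨ length≡sum-map-1 (filter unit? (map suc (upTo n))) ⟩
    sum (map (λ _ → 1) (filter unit? (map suc (upTo n))))
                                            ≡⟨ sum-filter-map-suc-upTo unit? (λ _ → 1) n
                                                 (common-divisor⇒gcd≢1 (p ∣0) (m∣m*n q)) ⟩
    ∑[ k < suc n ] when (unit? k) 1         ≡⟨ ∑<-suc n (λ k → when (unit? k) 1) ⟩
    U (λ _ → 1) + when (unit? n) 1          ≡⟨ cong (U (λ _ → 1) +_)
                                                 (when-no (unit? n) (common-divisor⇒gcd≢1 (m∣m*n q) (m∣m*n q)) 1) ⟩
    U (λ _ → 1) + 0                         ≡⟨ +-identityʳ _ ⟩
    U (λ _ → 1)                             ∎
    where open ≡-Reasoning

  ¬weakCarmichael[p*q] : ¬ WeakCarmichael n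
  ¬weakCarmichael[p*q] (_ , powerSum≡φ) = q∤U[1] (subst (q ∣_) φ≡U q∣φ)
    where
    q∣powerSum : q ∣ powerSum n
    q∣powerSum = subst (q ∣_) (sym powerSum≡U) q∣U[^m]
    q∣φ : q ∣ φ n
    q∣φ = ≈0⇒∣ (≈-trans (≈-sym (≡[mod]⇒≈ (n∣m*n p) powerSum≡φ)) (∣⇒≈0 q∣powerSum))

-- The primes need not be odd.
corollary2p20 : (p q : ℕ) → Prime p → Prime q → p ≢ 2 → q ≢ 2 → p ≢ q →
    ¬ WeakCarmichael (p * q)
corollary2p20 p q p-prime q-prime _ _ p≢q with <-cmp p q
... | tri< p<q _ _ = ¬weakCarmichael[p*q] p-prime q-prime p<q
... | tri≈ _ p≡q _ = contradiction p≡q p≢q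
... | tri> _ _ q<p = subst (λ n → ¬ WeakCarmichael n) (*-comm q p) (¬weakCarmichael[p*q] q-prime p-prime q<p)
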